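{- Let $S$ be a closed surface and $G$ an $S$-grid. Then $G=\mathcal{O}(H,H^*)$ (as embedded graphs in $S$, with the white vertices of $\mathcal{O}(H,H^*)$ forming one partite class) for some connected graph $H$ cellularly embedded in $S$ if and only if $G$ is bipartite with partite classes "black" and "white" such that every white vertex of $G$ has degree $4$ and the graph $R(G)$ is bipartite.
   Context: An $S$-grid is a graph embedded in the closed surface $S$ such that every facial boundary walk has length four. For a connected graph $H$ cellularly embedded in $S$ with topological dual $H^*$, the overlay graph $\mathcal{O}(H,H^*)$ is obtained by embedding $H$ (colored red) and $H^*$ (colored blue) simultaneously in $S$, each edge of $H$ crossing exactly its dual edge once, and placing a new "white" vertex of degree $4$ at each edge/dual-edge crossing point; it is an $S$-grid that is bipartite with partite classes $V(H)\cup V(H^*)$ (the black vertices) and the white vertices. For a bipartite $S$-grid $G$ with partite classes black and white, $R(G)$ is the graph obtained from $G$ by adding, in each (quadrilateral) face, a diagonal edge joining the two black corners of that face, and then deleting the white vertices of $G$. -}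

module Defs where

-- Cellularly embedded (connected) graphs in closed surfaces are encoded as
-- generalized maps ("gems", Lins 1982): a finite set of flags with three
-- fixed-point-free involutions t0, t1, t2 such that t0 t2 is a fixed-point-free
-- involution.  Vertices = orbits of <t1,t2>, edges = orbits of <t0,t2>,
-- faces = orbits of <t0,t1>.  This covers orientable and non-orientable
-- closed surfaces; gem isomorphism = equality of embedded graphs up to
-- homeomorphism of the surface.

open import Data.Nat using (ℕ; zero; suc; _<_)
open import Data.Fin using (Fin)
open import Data.Bool using (Bool; true; false)
open import Data.Product using (Σ; ∃; _×_; _,_)
open import Function.Base using (_∘_)
open import Function.Bundles using (_↔_; Inverse)
open import Relation.Binary.PropositionalEquality using (_≡_; _≢_)

record Gem : Set₁ where
  field
    Flag : Set
    t0 t1 t2 : Flag → Flag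

record IsGem (G : Gem) : Set where
  open Gem G
  field
    t0-invol : ∀ x → t0 (t0 x) ≡ x
    t1-invol : ∀ x → t1 (t1 x) ≡ x
    t2-invol : ∀ x → t2 (t2 x) ≡ x
    t0-fpf   : ∀ x → t0 x ≢ x
    t1-fpf   : ∀ x → t1 x ≢ x
    t2-fpf   : ∀ x → t2 x ≢ x
    t02-comm : ∀ x → t0 (t2 x) ≡ t2 (t0 x)
    t02-fpf  : ∀ x → t0 (t2 x) ≢ x
    finite   : ∃ λ n → Flag ↔ Fin n

data Reach (G : Gem) : Gem.Flag G → Gem.Flag G → Set where
  here  : ∀ {x} → Reach G x x
  step0 : ∀ {x y} → Reach G (Gem.t0 G x) y → Reach G x y
  step1 : ∀ {x y} → Reach G (Gem.t1 G x) y → Reach G x y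
  step2 : ∀ {x y} → Reach G (Gem.t2 G x) y → Reach G x y

Connected : Gem → Set
Connected G = Gem.Flag G × (∀ x y → Reach G x y)

iter : {A : Set} → (A → A) → ℕ → A → A
iter f zero x = x
iter f (suc k) x = f (iter f k x)

CycleLength : {A : Set} → (A → A) → A → ℕ → Set
CycleLength f x m = (iter f m x ≡ x) × (∀ k → 0 < k → k < m → iter f k x ≢ x)

FaceLength : (G : Gem) → Gem.Flag G → ℕ → Set
FaceLength G x m = CycleLength (Gem.t1 G ∘ Gem.t0 G) x m

-- degree of the vertex containing flag x (loops counted twice)
Degree : (G : Gem) → Gem.Flag G → ℕ → Set
Degree G x d = CycleLength (Gem.t2 G ∘ Gem.t1 G) x d

-- G is an S-grid (S = the surface of the gem): every facial walk has length 4
SGrid : Gem → Set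
SGrid G = IsGem G × Connected G × (∀ x → FaceLength G x 4)

-- Each flag (v,e,f) of H is split into four flags of
-- the overlay: vA = (v, half-edge v–m_e), mA = (m_e, v–m_e),
-- mB = (m_e, half-dual-edge m_e–f), fB = (f, m_e–f), where m_e is the white
-- crossing vertex; faces of O are the corners of H.
data Part : Set where
  vA mA mB fB : Part

module _ (H : Gem) where
  open Gem H
  private
    F = Flag × Part
    τ0 τ1 τ2 : F → F
    τ0 (x , vA) = (x , mA)
    τ0 (x , mA) = (x , vA)
    τ0 (x , mB) = (x , fB)
    τ0 (x , fB) = (x , mB)
    τ1 (x , vA) = (t1 x , vA)
    τ1 (x , mA) = (x , mB)
    τ1 (x , mB) = (x , mA)
    τ1 (x , fB) = (t1 x , fB)
    τ2 (x , vA) = (t2 x , vA)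
    τ2 (x , mA) = (t2 x , mA)
    τ2 (x , mB) = (t0 x , mB)
    τ2 (x , fB) = (t0 x , fB)

  Overlay : Gem
  Overlay = record { Flag = F ; t0 = τ0 ; t1 = τ1 ; t2 = τ2 }


record GemIso (G K : Gem) : Set where
  field
    φ : Gem.Flag G ↔ Gem.Flag K
  open Inverse φ using (to)
  field
    comm0 : ∀ x → to (Gem.t0 G x) ≡ Gem.t0 K (to x)
    comm1 : ∀ x → to (Gem.t1 G x) ≡ Gem.t1 K (to x)
    comm2 : ∀ x → to (Gem.t2 G x) ≡ Gem.t2 K (to x)

VertexColouring : (G : Gem) → (Gem.Flag G → Bool) → Set
VertexColouring G c = (∀ x → c (Gem.t1 G x) ≡ c x) × (∀ x → c (Gem.t2 G x) ≡ c x)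

-- proper 2-colouring of the graph of G (true = black, false = white):
-- the two ends (vertices of x and t0 x) of every edge get different colours
BipartiteBy : (G : Gem) → (Gem.Flag G → Bool) → Set
BipartiteBy G c = VertexColouring G c × (∀ x → c (Gem.t0 G x) ≢ c x)

-- R(G) for a quadrangulation G with black/white colouring col:
-- vertices = black vertices; for every face, the diagonal joins the black
-- corner at black flag x with the opposite corner, at flag t0 t1 t0 x.
RBipartite : (G : Gem) → (Gem.Flag G → Bool) → Set
RBipartite G col =
  Σ (Gem.Flag G → Bool) λ d →
    VertexColouring G d ×
    (∀ x → col x ≡ true →
       d (Gem.t0 G (Gem.t1 G (Gem.t0 G x))) ≢ d x)

-- Forward: colour a flag of O(H,H*) black when it sits at a vertex or a face
-- of H, and colour the black vertices of R(O(H,H*)), whose edges join each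
-- vertex of H to the faces around it, by "vertex of H" versus "face of H".
-- These colourings are carried along the isomorphism G ≅ O(H,H*).
--
-- Backward: the vertices of H are the black vertices on one side of the
-- bipartition of R(G).  Their flags, with t1 and t2 inherited from G and t0
-- replaced by the crossing of the (degree 4) white vertex at the end of the
-- edge, form a gem H.  A flag of G is determined by its colour and the side of
-- R(G) it is attached to; this identifies G with O(H,H*), the two 4-cycle
-- conditions (faces of length 4, white vertices of degree 4) giving the
-- commutations with t1 and t2.
module Submission where

open import Defs
open import Data.Nat using (zero; suc; _+_; _<_; s≤s; z≤n)
open import Data.Fin using (Fin; zero; suc)
open import Data.Fin.Properties using (+↔⊎)
open import Data.Bool using (Bool; true; false; not; if_then_else_)
open import Data.Bool.Properties using (¬-not; not-involutive) renaming (_≟_ to _≟ᵇ_)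
open import Data.Product using (Σ; ∃; _×_; _,_; proj₁; proj₂)
open import Data.Product.Properties using (,-injectiveˡ; Σ-≡,≡→≡)
open import Data.Product.Function.Dependent.Propositional as Σ using ()
open import Data.Sum using (_⊎_; inj₁; inj₂)
open import Data.Sum.Function.Propositional using (_⊎-↔_)
open import Data.Empty using (⊥-elim)
open import Function.Base using (_∘_)
open import Function.Bundles using (_↔_; Inverse; Injection; mk↔ₛ′; _⇔_; mk⇔)
open import Function.Properties.Inverse using (↔-refl; ↔-sym; ↔-trans; ↔⇒↣)
open import Relation.Nullary using (Dec; yes; no; Irrelevant)
open import Relation.Nullary.Decidable using (_×-dec_)
open import Relation.Unary using (Decidable)
open import Relation.Binary.PropositionalEquality
open import Axiom.UniquenessOfIdentityProofs using (module Decidable⇒UIP)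

private
  variable
    A B : Set

Finite : Set → Set
Finite A = ∃ λ n → A ↔ Fin n

decidableProp-finite : Dec A → Irrelevant A → Finite A
decidableProp-finite (yes a) irr =
  1 , mk↔ₛ′ (λ _ → zero) (λ _ → a) (λ { zero → refl }) (irr a)
decidableProp-finite (no ¬a) irr =
  0 , mk↔ₛ′ (⊥-elim ∘ ¬a) (λ ()) (λ ()) (⊥-elim ∘ ¬a)

Σ-Fin-suc↔ : ∀ {m} {P : Fin (suc m) → Set} → Σ (Fin (suc m)) P ↔ (P zero ⊎ Σ (Fin m) (P ∘ suc))
Σ-Fin-suc↔ {P = P} = mk↔ₛ′ split join split∘join join∘split
  where
  split : Σ _ P → P zero ⊎ Σ _ (P ∘ suc)
  split (zero , p) = inj₁ p
  split (suc i , p) = inj₂ (i , p)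
  join : P zero ⊎ Σ _ (P ∘ suc) → Σ _ P
  join (inj₁ p) = zero , p
  join (inj₂ (i , p)) = suc i , p
  split∘join : ∀ s → split (join s) ≡ s
  split∘join (inj₁ _) = refl
  split∘join (inj₂ _) = refl
  join∘split : ∀ s → join (split s) ≡ s
  join∘split (zero , _) = refl
  join∘split (suc _ , _) = refl

Fin-subset-finite : ∀ m {P : Fin m → Set} → Decidable P → (∀ i → Irrelevant (P i)) →
  Finite (Σ (Fin m) P)
Fin-subset-finite zero dec irr = 0 , mk↔ₛ′ (λ { (() , _) }) (λ ()) (λ ()) (λ { (() , _) })
Fin-subset-finite (suc m) dec irr
  with decidableProp-finite (dec zero) (irr zero)
     | Fin-subset-finite m (dec ∘ suc) (irr ∘ suc)
... | k₀ , e₀ | k , e = k₀ + k , ↔-trans Σ-Fin-suc↔ (↔-trans (e₀ ⊎-↔ e) (↔-sym +↔⊎))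

subtype-finite : {P : A → Set} → Decidable P → (∀ a → Irrelevant (P a)) →
  Finite A → Finite (Σ A P)
subtype-finite dec irr (n , e) with Fin-subset-finite n (dec ∘ from) (irr ∘ from)
  where open Inverse e
... | k , e′ = k , ↔-trans (↔-sym (Σ.cong (↔-sym e) ↔-refl)) e′

module _ {f : A → A} (f-invol : ∀ x → f (f x) ≡ x) where

  involutive-transpose : ∀ {u v} → f u ≡ v → u ≡ f v
  involutive-transpose {u} fu≡v = trans (sym (f-invol u)) (cong f fu≡v)

  involutive-injective : ∀ {u v} → f u ≡ f v → u ≡ v
  involutive-injective fu≡fv = trans (involutive-transpose fu≡fv) (f-invol _)

  conjugate-involutive : {g : A → A} → (∀ x → g (g x) ≡ x) → ∀ x → f (g (f (f (g (f x))))) ≡ x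
  conjugate-involutive {g} g-invol x = begin
    f (g (f (f (g (f x))))) ≡⟨ cong (f ∘ g) (f-invol _) ⟩
    f (g (g (f x)))         ≡⟨ cong f (g-invol _) ⟩
    f (f x)                 ≡⟨ f-invol x ⟩
    x                       ∎
    where open ≡-Reasoning

  commuting-involutive : {g : A → A} → (∀ x → g (g x) ≡ x) → (∀ x → f (g x) ≡ g (f x)) →
    ∀ x → f (g (f (g x))) ≡ x
  commuting-involutive {g} g-invol comm x = begin
    f (g (f (g x))) ≡⟨ cong f (sym (comm (g x))) ⟩
    f (f (g (g x))) ≡⟨ f-invol _ ⟩
    g (g x)         ≡⟨ g-invol x ⟩
    x               ∎
    where open ≡-Reasoning

fourCycle⇒braid : {f g : A → A} → (∀ x → f (f x) ≡ x) → (∀ x → g (g x) ≡ x) →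
  ∀ {x} → iter (g ∘ f) 4 x ≡ x → g (f (g (f x))) ≡ f (g (f (g x)))
fourCycle⇒braid {f = f} {g} f-invol g-invol cycle =
  transpose-f (transpose-g (transpose-f (transpose-g cycle)))
  where
  transpose-f : ∀ {u v} → f u ≡ v → u ≡ f v
  transpose-f = involutive-transpose f-invol
  transpose-g : ∀ {u v} → g u ≡ v → u ≡ g v
  transpose-g = involutive-transpose g-invol

iter-commute : (h : A → B) {f : A → A} {g : B → B} → (∀ x → h (f x) ≡ g (h x)) →
  ∀ k x → h (iter f k x) ≡ iter g k (h x)
iter-commute h comm zero x = refl
iter-commute h {g = g} comm (suc k) x = trans (comm (iter _ k x)) (cong g (iter-commute h comm k x))

cycleLength-transport : (e : A ↔ B) {f : A → A} {g : B → B} →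
  (∀ x → Inverse.to e (f x) ≡ g (Inverse.to e x)) →
  ∀ x m → CycleLength g (Inverse.to e x) m → CycleLength f x m
cycleLength-transport e comm x m (returns , minimal) =
  Injection.injective (↔⇒↣ e) (trans (iter-commute to comm m x) returns) ,
  λ k 0<k k<m fᵏx≡x → minimal k 0<k k<m (trans (sym (iter-commute to comm k x)) (cong to fᵏx≡x))
  where open Inverse e

OverlayColouring : (G : Gem) → (Gem.Flag G → Bool) → Set
OverlayColouring G col =
  BipartiteBy G col × (∀ x → col x ≡ false → Degree G x 4) × RBipartite G col

module _ {G K : Gem} (I : GemIso G K) where
  open GemIso I
  open Inverse φ
  private
    module G = Gem G
    module K = Gem K

  reach-transport : ∀ {x y} → Reach G x y → Reach K (to x) (to y)
  reach-transport here = here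
  reach-transport (step0 {x} r) = step0 (subst (λ z → Reach K z _) (comm0 x) (reach-transport r))
  reach-transport (step1 {x} r) = step1 (subst (λ z → Reach K z _) (comm1 x) (reach-transport r))
  reach-transport (step2 {x} r) = step2 (subst (λ z → Reach K z _) (comm2 x) (reach-transport r))

  connected-transport : Connected G → Connected K
  connected-transport (x , reach) = to x , λ a b →
    subst₂ (Reach K) (strictlyInverseˡ a) (strictlyInverseˡ b) (reach-transport (reach (from a) (from b)))

  vertexColouring-transport : ∀ {c} → VertexColouring K c → VertexColouring G (c ∘ to)
  vertexColouring-transport {c} (c-t1 , c-t2) =
    (λ x → trans (cong c (comm1 x)) (c-t1 (to x))) ,
    (λ x → trans (cong c (comm2 x)) (c-t2 (to x)))

  bipartiteBy-transport : ∀ {c} → BipartiteBy K c → BipartiteBy G (c ∘ to)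
  bipartiteBy-transport {c} (vc , c-t0) =
    vertexColouring-transport vc , λ x → c-t0 (to x) ∘ trans (sym (cong c (comm0 x)))

  to-diagonal : ∀ x → to (G.t0 (G.t1 (G.t0 x))) ≡ K.t0 (K.t1 (K.t0 (to x)))
  to-diagonal x = trans (comm0 _) (cong K.t0 (trans (comm1 _) (cong K.t1 (comm0 x))))

  rBipartite-transport : ∀ {c} → RBipartite K c → RBipartite G (c ∘ to)
  rBipartite-transport (d , vd , d-diagonal) =
    d ∘ to , vertexColouring-transport vd ,
    λ x cx → d-diagonal (to x) cx ∘ trans (sym (cong d (to-diagonal x)))

  degree-transport : ∀ x n → Degree K (to x) n → Degree G x n
  degree-transport = cycleLength-transport φ λ x → trans (comm2 (G.t1 x)) (cong K.t2 (comm1 x))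

  overlayColouring-transport : ∀ {c} → OverlayColouring K c → OverlayColouring G (c ∘ to)
  overlayColouring-transport (bip , white-degree , rbip) =
    bipartiteBy-transport bip ,
    (λ x cx → degree-transport x 4 (white-degree (to x) cx)) ,
    rBipartite-transport rbip

gemIso-sym : {G K : Gem} → GemIso G K → GemIso K G
gemIso-sym {G} I = record
  { φ = ↔-sym φ
  ; comm0 = from-comm {Gem.t0 G} comm0
  ; comm1 = from-comm {Gem.t1 G} comm1
  ; comm2 = from-comm {Gem.t2 G} comm2
  }
  where
  open GemIso I
  open Inverse φ
  from-comm : ∀ {f g} → (∀ x → to (f x) ≡ g (to x)) → ∀ y → from (g y) ≡ f (from y)
  from-comm {f} {g} comm y = begin
    from (g y)             ≡⟨ cong (from ∘ g) (strictlyInverseˡ y) ⟨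
    from (g (to (from y))) ≡⟨ cong from (comm (from y)) ⟨
    from (to (f (from y))) ≡⟨ strictlyInverseʳ _ ⟩
    f (from y)             ∎
    where open ≡-Reasoning

partColour : Part → Bool
partColour vA = true
partColour mA = false
partColour mB = false
partColour fB = true

-- The side of a black vertex of R(O(H,H*)): vertex of H or face of H.  The
-- value at the white parts mA, mB is irrelevant.
partSide : Part → Bool
partSide fB = false
partSide _  = true

module _ (H : Gem) where
  open Gem H
  private
    O = Overlay H
    module O = Gem O

  overlay-vertexColouring : (c : Part → Bool) → c mA ≡ c mB → VertexColouring O (c ∘ proj₂)
  overlay-vertexColouring c cmA≡cmB =
    (λ { (_ , vA) → refl ; (_ , mA) → sym cmA≡cmB ; (_ , mB) → cmA≡cmB ; (_ , fB) → refl }) ,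
    (λ { (_ , vA) → refl ; (_ , mA) → refl ; (_ , mB) → refl ; (_ , fB) → refl })

  overlay-bipartiteBy : BipartiteBy O (partColour ∘ proj₂)
  overlay-bipartiteBy = overlay-vertexColouring partColour refl ,
    λ { (_ , vA) () ; (_ , mA) () ; (_ , mB) () ; (_ , fB) () }

  overlay-rBipartite : RBipartite O (partColour ∘ proj₂)
  overlay-rBipartite = partSide ∘ proj₂ , overlay-vertexColouring partSide refl ,
    λ { (_ , vA) _ () ; (_ , fB) _ () }

  overlay-whiteDegree : IsGem H → ∀ p → partColour (proj₂ p) ≡ false → Degree O p 4
  overlay-whiteDegree isH (a , mA) _ =
    cong (_, mA) (commuting-involutive {f = t2} t2-invol {g = t0} t0-invol (sym ∘ t02-comm) a) , minimal
    where
    open IsGem isH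
    minimal : ∀ k → 0 < k → k < 4 → iter (O.t2 ∘ O.t1) k (a , mA) ≢ (a , mA)
    minimal 1 _ _ ()
    minimal 2 _ _ eq = t02-fpf a (trans (t02-comm a) (,-injectiveˡ eq))
    minimal 3 _ _ ()
    minimal (suc (suc (suc (suc _)))) _ (s≤s (s≤s (s≤s (s≤s ()))))
  overlay-whiteDegree isH (a , mB) _ =
    cong (_, mB) (commuting-involutive {f = t0} t0-invol {g = t2} t2-invol t02-comm a) , minimal
    where
    open IsGem isH
    minimal : ∀ k → 0 < k → k < 4 → iter (O.t2 ∘ O.t1) k (a , mB) ≢ (a , mB)
    minimal 1 _ _ ()
    minimal 2 _ _ eq = t02-fpf a (,-injectiveˡ eq)
    minimal 3 _ _ ()
    minimal (suc (suc (suc (suc _)))) _ (s≤s (s≤s (s≤s (s≤s ()))))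

  overlay-overlayColouring : IsGem H → OverlayColouring O (partColour ∘ proj₂)
  overlay-overlayColouring isH = overlay-bipartiteBy , overlay-whiteDegree isH , overlay-rBipartite

  overlay-reach : ∀ {u v} → Reach O u v → Reach H (proj₁ u) (proj₁ v)
  overlay-reach here = here
  overlay-reach (step0 {_ , vA} r) = overlay-reach r
  overlay-reach (step0 {_ , mA} r) = overlay-reach r
  overlay-reach (step0 {_ , mB} r) = overlay-reach r
  overlay-reach (step0 {_ , fB} r) = overlay-reach r
  overlay-reach (step1 {_ , vA} r) = step1 (overlay-reach r)
  overlay-reach (step1 {_ , mA} r) = overlay-reach r
  overlay-reach (step1 {_ , mB} r) = overlay-reach r
  overlay-reach (step1 {_ , fB} r) = step1 (overlay-reach r)
  overlay-reach (step2 {_ , vA} r) = step2 (overlay-reach r)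
  overlay-reach (step2 {_ , mA} r) = step2 (overlay-reach r)
  overlay-reach (step2 {_ , mB} r) = step0 (overlay-reach r)
  overlay-reach (step2 {_ , fB} r) = step0 (overlay-reach r)

  overlay-connected⇒connected : Connected O → Connected H
  overlay-connected⇒connected ((x , _) , reach) = x , λ a b → overlay-reach (reach (a , vA) (b , vA))

module Reconstruction
  (G : Gem) (isG : IsGem G) (face4 : ∀ x → FaceLength G x 4)
  (col : Gem.Flag G → Bool) (bip : BipartiteBy G col)
  (white-degree : ∀ x → col x ≡ false → Degree G x 4)
  (d : Gem.Flag G → Bool) (d-vertex : VertexColouring G d)
  (d-proper : ∀ x → col x ≡ true → d (Gem.t0 G (Gem.t1 G (Gem.t0 G x))) ≢ d x) where

  open Gem G
  open IsGem isG

  col-t0 : ∀ x → col (t0 x) ≡ not (col x)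
  col-t0 x = ¬-not (proj₂ bip x)

  col-t1 : ∀ x → col (t1 x) ≡ col x
  col-t1 = proj₁ (proj₁ bip)

  col-t2 : ∀ x → col (t2 x) ≡ col x
  col-t2 = proj₂ (proj₁ bip)

  black-t0 : ∀ {x} → col x ≡ false → col (t0 x) ≡ true
  black-t0 cx = trans (col-t0 _) (cong not cx)

  white-t0 : ∀ {x} → col x ≡ true → col (t0 x) ≡ false
  white-t0 cx = trans (col-t0 _) (cong not cx)

  diagonal : Flag → Flag
  diagonal x = t0 (t1 (t0 x))

  diagonal-involutive : ∀ x → diagonal (diagonal x) ≡ x
  diagonal-involutive = conjugate-involutive {f = t0} t0-invol {g = t1} t1-invol

  col-diagonal : ∀ x → col (diagonal x) ≡ col x
  col-diagonal x = begin
    col (t0 (t1 (t0 x)))   ≡⟨ col-t0 _ ⟩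
    not (col (t1 (t0 x)))  ≡⟨ cong not (col-t1 _) ⟩
    not (col (t0 x))       ≡⟨ cong not (col-t0 x) ⟩
    not (not (col x))      ≡⟨ not-involutive _ ⟩
    col x                  ∎
    where open ≡-Reasoning

  d-diagonal : ∀ {x} → col x ≡ true → d (diagonal x) ≡ not (d x)
  d-diagonal cx = ¬-not (d-proper _ cx)

  Primal : Flag → Set
  Primal y = col y ≡ true × d y ≡ true

  HFlag : Set
  HFlag = Σ Flag Primal

  primal? : Decidable Primal
  primal? y = (col y ≟ᵇ true) ×-dec (d y ≟ᵇ true)

  primal-irrelevant : ∀ y → Irrelevant (Primal y)
  primal-irrelevant y (c , e) (c′ , e′) = cong₂ _,_ (≡-irrelevant c c′) (≡-irrelevant e e′)
    where open Decidable⇒UIP _≟ᵇ_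

  HFlag-≡ : ∀ {a b : HFlag} → proj₁ a ≡ proj₁ b → a ≡ b
  HFlag-≡ eq = Σ-≡,≡→≡ (eq , primal-irrelevant _ _ _)

  -- t0 goes to the white vertex at the other end of the edge, t1 t2 t1 turns
  -- to the opposite edge there (the vertex has degree 4), and t0 leaves along it.
  across : Flag → Flag
  across y = t0 (t1 (t2 (t1 (t0 y))))

  col-across : ∀ y → col (across y) ≡ col y
  col-across y = begin
    col (t0 (t1 (t2 (t1 (t0 y))))) ≡⟨ col-t0 _ ⟩
    not (col (t1 (t2 (t1 (t0 y))))) ≡⟨ cong not (trans (col-t1 _) (trans (col-t2 _) (col-t1 _))) ⟩
    not (col (t0 y))                ≡⟨ cong not (col-t0 y) ⟩
    not (not (col y))               ≡⟨ not-involutive _ ⟩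
    col y                           ∎
    where open ≡-Reasoning

  across-primal : ∀ {y} → Primal y → Primal (across y)
  across-primal {y} (cy , dy) = trans (col-across y) cy , d-across
    where
    w = t2 (t1 (t0 y))
    cw : col (t0 w) ≡ true
    cw = black-t0 (trans (col-t2 _) (trans (col-t1 _) (white-t0 cy)))
    d-across : d (across y) ≡ true
    d-across = begin
      d (across y)              ≡⟨ cong (d ∘ t0 ∘ t1) (t0-invol w) ⟨
      d (diagonal (t0 w))       ≡⟨ d-diagonal cw ⟩
      not (d (t0 (t2 (t1 (t0 y))))) ≡⟨ cong (not ∘ d) (t02-comm _) ⟩
      not (d (t2 (diagonal y))) ≡⟨ cong not (proj₂ d-vertex _) ⟩
      not (d (diagonal y))      ≡⟨ cong not (d-diagonal cy) ⟩
      not (not (d y))           ≡⟨ cong (not ∘ not) dy ⟩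
      true                      ∎
      where open ≡-Reasoning

  white-braid : ∀ {z} → col z ≡ false → t2 (t1 (t2 (t1 z))) ≡ t1 (t2 (t1 (t2 z)))
  white-braid cz = fourCycle⇒braid {f = t1} {g = t2} t1-invol t2-invol (proj₁ (white-degree _ cz))

  across-t2 : ∀ {y} → col y ≡ true → across (t2 y) ≡ t0 (t2 (t1 (t2 (t1 (t0 y)))))
  across-t2 {y} cy = begin
    t0 (t1 (t2 (t1 (t0 (t2 y))))) ≡⟨ cong (t0 ∘ t1 ∘ t2 ∘ t1) (t02-comm y) ⟩
    t0 (t1 (t2 (t1 (t2 (t0 y))))) ≡⟨ cong t0 (white-braid (white-t0 cy)) ⟨
    t0 (t2 (t1 (t2 (t1 (t0 y))))) ∎
    where open ≡-Reasoning

  lift : (f : Flag → Flag) → (∀ {y} → Primal y → Primal (f y)) → HFlag → HFlag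
  lift f f-primal (y , p) = f y , f-primal p

  H : Gem
  H = record
    { Flag = HFlag
    ; t0 = lift across across-primal
    ; t1 = lift t1 λ (cy , dy) → trans (col-t1 _) cy , trans (proj₁ d-vertex _) dy
    ; t2 = lift t2 λ (cy , dy) → trans (col-t2 _) cy , trans (proj₂ d-vertex _) dy
    }

  isH : IsGem H
  isH = record
    { t0-invol = λ (y , _) → HFlag-≡ (conjugate-involutive {f = t0} t0-invol {g = t1 ∘ t2 ∘ t1}
                                    (conjugate-involutive {f = t1} t1-invol {g = t2} t2-invol) y)
    ; t1-invol = λ (y , _) → HFlag-≡ (t1-invol y)
    ; t2-invol = λ (y , _) → HFlag-≡ (t2-invol y)
    ; t0-fpf = λ (y , _) eq → t2-fpf _
        (involutive-transpose {f = t1} t1-invol (involutive-transpose {f = t0} t0-invol (cong proj₁ eq)))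
    ; t1-fpf = λ (y , _) eq → t1-fpf y (cong proj₁ eq)
    ; t2-fpf = λ (y , _) eq → t2-fpf y (cong proj₁ eq)
    ; t02-comm = λ (y , cy , _) → HFlag-≡ (trans (across-t2 cy) (t02-comm _))
    ; t02-fpf = λ (y , cy , _) eq →
        proj₂ (white-degree (t0 y) (white-t0 cy)) 2 (s≤s z≤n) (s≤s (s≤s (s≤s z≤n)))
          (involutive-transpose {f = t0} t0-invol (trans (sym (across-t2 cy)) (cong proj₁ eq)))
    ; finite = subtype-finite primal? primal-irrelevant finite
    }

  O : Gem
  O = Overlay H

  embed : HFlag × Part → Flag
  embed ((y , _) , vA) = y
  embed ((y , _) , mA) = t0 y
  embed ((y , _) , mB) = t1 (t0 y)
  embed ((y , _) , fB) = diagonal y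

  -- A flag of G is placed in the overlay by its colour and the side of R(G)
  -- of its black end.
  kind : Flag → Part
  kind z = if col z then (if d z then vA else fB) else (if d (t0 z) then mA else mB)

  kind-embed : ∀ u → kind (embed u) ≡ proj₂ u
  kind-embed ((y , cy , dy) , vA) rewrite cy | dy = refl
  kind-embed ((y , cy , dy) , mA)
    rewrite col-t0 y | cy | t0-invol y | dy = refl
  kind-embed ((y , cy , dy) , mB)
    rewrite col-t1 (t0 y) | col-t0 y | cy | d-diagonal cy | dy = refl
  kind-embed ((y , cy , dy) , fB)
    rewrite col-diagonal y | cy | d-diagonal cy | dy = refl

  embed-cancel : ∀ {a b} p → embed (a , p) ≡ embed (b , p) → a ≡ b
  embed-cancel vA eq = HFlag-≡ eq
  embed-cancel mA eq = HFlag-≡ (involutive-injective {f = t0} t0-invol eq)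
  embed-cancel mB eq = HFlag-≡ (involutive-injective {f = t0} t0-invol (involutive-injective {f = t1} t1-invol eq))
  embed-cancel fB eq = HFlag-≡ (involutive-injective {f = diagonal} diagonal-involutive eq)

  embed-injective : ∀ {u v} → embed u ≡ embed v → u ≡ v
  embed-injective {a , p} {b , q} eq = same-part p≡q eq
    where
    p≡q : p ≡ q
    p≡q = trans (sym (kind-embed (a , p))) (trans (cong kind eq) (kind-embed (b , q)))
    same-part : p ≡ q → embed (a , p) ≡ embed (b , q) → (a , p) ≡ (b , q)
    same-part refl eq = cong (_, p) (embed-cancel p eq)

  embed-surjective : ∀ z → Σ (HFlag × Part) λ u → embed u ≡ z
  embed-surjective z with col z in cz | d z in dz | d (t0 z) in dz₀
  ... | true | true | _ = ((z , cz , dz) , vA) , refl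
  ... | true | false | _ =
    ((diagonal z , trans (col-diagonal z) cz , trans (d-diagonal cz) (cong not dz)) , fB) ,
    diagonal-involutive z
  ... | false | _ | true =
    ((t0 z , black-t0 cz , dz₀) , mA) , t0-invol z
  ... | false | _ | false =
    ((t0 (t1 z) , black-t0 (trans (col-t1 z) cz) , d-t0t1) , mB) ,
    trans (cong t1 (t0-invol _)) (t1-invol z)
    where
    d-t0t1 : d (t0 (t1 z)) ≡ true
    d-t0t1 = trans (cong (d ∘ t0 ∘ t1) (sym (t0-invol z))) (trans (d-diagonal (black-t0 cz)) (cong not dz₀))

  embed-t0 : ∀ u → embed (Gem.t0 O u) ≡ t0 (embed u)
  embed-t0 ((y , _) , vA) = refl
  embed-t0 ((y , _) , mA) = sym (t0-invol y)
  embed-t0 ((y , _) , mB) = refl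
  embed-t0 ((y , _) , fB) = sym (t0-invol _)

  embed-t1 : ∀ u → embed (Gem.t1 O u) ≡ t1 (embed u)
  embed-t1 ((y , _) , vA) = refl
  embed-t1 ((y , _) , mA) = refl
  embed-t1 ((y , _) , mB) = sym (t1-invol _)
  embed-t1 ((y , _) , fB) = sym (fourCycle⇒braid {f = t0} {g = t1} t0-invol t1-invol (proj₁ (face4 y)))

  embed-t2 : ∀ u → embed (Gem.t2 O u) ≡ t2 (embed u)
  embed-t2 ((y , _) , vA) = refl
  embed-t2 ((y , _) , mA) = t02-comm y
  embed-t2 ((y , _) , mB) = trans (cong t1 (t0-invol _)) (t1-invol _)
  embed-t2 ((y , _) , fB) = trans (cong (t0 ∘ t1) (t0-invol _)) (trans (cong t0 (t1-invol _)) (t02-comm _))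

  overlay≅G : GemIso O G
  overlay≅G = record
    { φ = mk↔ₛ′ embed (proj₁ ∘ embed-surjective) (proj₂ ∘ embed-surjective)
            (λ u → embed-injective (proj₂ (embed-surjective (embed u))))
    ; comm0 = embed-t0 ; comm1 = embed-t1 ; comm2 = embed-t2 }

IsOverlay : Gem → Set₁
IsOverlay G = Σ Gem λ H → IsGem H × Connected H × GemIso G (Overlay H)

overlay⇒overlayColouring : (G : Gem) → IsOverlay G → Σ (Gem.Flag G → Bool) (OverlayColouring G)
overlay⇒overlayColouring G (H , isH , _ , I) = _ , overlayColouring-transport I (overlay-overlayColouring H isH)

overlayColouring⇒overlay : (G : Gem) → SGrid G → Σ (Gem.Flag G → Bool) (OverlayColouring G) → IsOverlay G
overlayColouring⇒overlay G (isG , connected , face4) (col , bip , white-degree , d , d-vertex , d-proper) =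
  H , isH , overlay-connected⇒connected H (connected-transport (gemIso-sym overlay≅G) connected) ,
  gemIso-sym overlay≅G
  where open Reconstruction G isG face4 col bip white-degree d d-vertex d-proper

proposition7 : (G : Gem) → SGrid G →
    (Σ Gem λ H → IsGem H × Connected H × GemIso G (Overlay H))
    ⇔ (Σ (Gem.Flag G → Bool) λ col →
          BipartiteBy G col
        × (∀ x → col x ≡ false → Degree G x 4)
        × RBipartite G col)
proposition7 G sg = mk⇔ (overlay⇒overlayColouring G) (overlayColouring⇒overlay G sg)
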